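{- Let $p(\cdot)=\sum_{H\in\mathcal{H}}\alpha_H\hom(H,\cdot)$ be a graph motif parameter on uncolored graphs, with $\mathcal{H}$ a finite set of pairwise non-isomorphic uncolored graphs and $\alpha_H\in\mathbb{Q}$. Let $C$ be a set of colors and define the graph parameter on colored graphs (with colors in $C$) $$p_{\mathrm{col}}(\cdot)=\sum_{H\in\mathcal{H}}\alpha_H\sum_{c:V(H)\to C}\hom(H^c,\cdot).$$ Then $p(G^{\circ})=p_{\mathrm{col}}(G)$ for every colored graph $G$ with colors in $C$. Moreover, after collecting isomorphic terms, the coefficient in $p_{\mathrm{col}}$ of any colored graph $F$ whose coloring is a bijection $V(F)\to C$ equals $\alpha_{F^{\circ}}\,|\mathrm{aut}(F^{\circ})|$.
   Context: Homomorphisms between colored graphs preserve edges and colors; $\hom(H,G)$ counts them. $G^{\circ}$ is the uncolored graph underlying a colored graph $G$; $H^c$ is the uncolored graph $H$ equipped with the coloring $c$. $\mathrm{aut}(F^{\circ})$ is the automorphism group of $F^{\circ}$. $\alpha_{F^{\circ}}$ denotes the coefficient $\alpha_H$ of the $H\in\mathcal{H}$ isomorphic to $F^{\circ}$ (and $0$ if there is none). -}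

module Defs where

open import Data.Nat using (ℕ; zero; suc; _+_)
open import Data.Bool using (Bool; true; false; _∧_; _∨_; not; if_then_else_; T)
open import Data.Fin using (Fin)
open import Data.Fin.Properties using (_≟_)
open import Data.List using (List; []; _∷_; map; allFin)
open import Data.Nat.ListAction using (sum)
open import Data.Bool.ListAction using (all; any)
open import Data.Product using (_×_; _,_; proj₁; proj₂)
open import Data.Vec.Functional using () renaming (_∷_ to _◂_)
open import Data.Integer using (+_)
open import Data.Rational using (ℚ; 0ℚ; _/_) renaming (_+_ to _+ℚ_; _*_ to _*ℚ_)
open import Relation.Nullary.Decidable using (⌊_⌋)
open import Relation.Binary.PropositionalEquality using (_≡_)

sumFuns : (k m : ℕ) → ((Fin k → Fin m) → ℕ) → ℕ
sumFuns zero    m g = g (λ ())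
sumFuns (suc k) m g = sum (map (λ i → sumFuns k m (λ f → g (i ◂ f))) (allFin m))

countFuns : (k m : ℕ) → ((Fin k → Fin m) → Bool) → ℕ
countFuns k m P = sumFuns k m (λ f → if P f then 1 else 0)

anyFun : (k m : ℕ) → ((Fin k → Fin m) → Bool) → Bool
anyFun k m P = not ⌊ countFuns k m P Data.Nat.≟ 0 ⌋

allFin? : (n : ℕ) → (Fin n → Bool) → Bool
allFin? n P = all P (allFin n)

anyFin? : (n : ℕ) → (Fin n → Bool) → Bool
anyFin? n P = any P (allFin n)

_==_ : ∀ {n} → Fin n → Fin n → Bool
x == y = ⌊ x ≟ y ⌋

_⇔ᵇ_ : Bool → Bool → Bool
true  ⇔ᵇ b = b
false ⇔ᵇ b = not b

record Graph : Set where
  field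
    n      : ℕ
    adj    : Fin n → Fin n → Bool
    sym    : ∀ u v → adj u v ≡ adj v u
    irrefl : ∀ v → adj v v ≡ false
open Graph public

record ColGraph (q : ℕ) : Set where
  field
    graph : Graph
    col   : Fin (n graph) → Fin q
open ColGraph public

_° : ∀ {q} → ColGraph q → Graph
G ° = graph G

_^_ : ∀ {q} (H : Graph) → (Fin (n H) → Fin q) → ColGraph q
H ^ c = record { graph = H ; col = c }

isHomᵇ : (H G : Graph) → (Fin (n H) → Fin (n G)) → Bool
isHomᵇ H G f = allFin? (n H) λ u → allFin? (n H) λ v →
  not (adj H u v) ∨ adj G (f u) (f v)

preservesColᵇ : ∀ {q} (H G : ColGraph q) → (Fin (n (graph H)) → Fin (n (graph G))) → Bool
preservesColᵇ H G f = allFin? (n (graph H)) λ v → col G (f v) == col H v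

hom : Graph → Graph → ℕ
hom H G = countFuns (n H) (n G) (isHomᵇ H G)

homCol : ∀ {q} → ColGraph q → ColGraph q → ℕ
homCol H G = countFuns (n (graph H)) (n (graph G))
  (λ f → isHomᵇ (graph H) (graph G) f ∧ preservesColᵇ H G f)

isBijᵇ : ∀ {k m} → (Fin k → Fin m) → Bool
isBijᵇ {k} {m} f =
  (allFin? k λ u → allFin? k λ v → not (f u == f v) ∨ (u == v)) ∧
  (allFin? m λ w → anyFin? k λ u → f u == w)

isIsoMapᵇ : (H G : Graph) → (Fin (n H) → Fin (n G)) → Bool
isIsoMapᵇ H G f = isBijᵇ f ∧
  (allFin? (n H) λ u → allFin? (n H) λ v → adj H u v ⇔ᵇ adj G (f u) (f v))

Iso : Graph → Graph → Set
Iso H G = T (anyFun (n H) (n G) (isIsoMapᵇ H G))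

IsoCol : ∀ {q} → ColGraph q → ColGraph q → Set
IsoCol H G = T (anyFun (n (graph H)) (n (graph G))
  (λ f → isIsoMapᵇ (graph H) (graph G) f ∧ preservesColᵇ H G f))

IsoColᵇ : ∀ {q} → ColGraph q → ColGraph q → Bool
IsoColᵇ H G = anyFun (n (graph H)) (n (graph G))
  (λ f → isIsoMapᵇ (graph H) (graph G) f ∧ preservesColᵇ H G f)

aut : Graph → ℕ
aut F = countFuns (n F) (n F) (isIsoMapᵇ F F)

ℕ→ℚ : ℕ → ℚ
ℕ→ℚ k = (+ k) / 1

Motif : Set
Motif = List (Graph × ℚ)

p : Motif → Graph → ℚ
p []              G = 0ℚ
p ((H , α) ∷ ℋ) G = α *ℚ ℕ→ℚ (hom H G) +ℚ p ℋ G

pcol : ∀ {q} → Motif → ColGraph q → ℚ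
pcol []            G = 0ℚ
pcol {q} ((H , α) ∷ ℋ) G =
  α *ℚ ℕ→ℚ (sumFuns (n H) q (λ c → homCol (H ^ c) G)) +ℚ pcol ℋ G

-- Coefficient of the colored graph F in p_col after collecting isomorphic
-- terms:  Σ_{H∈ℋ} α_H · #{ c : V(H) → C | H^c ≅ F }
coeffCol : ∀ {q} → Motif → ColGraph q → ℚ
coeffCol []            F = 0ℚ
coeffCol {q} ((H , α) ∷ ℋ) F =
  α *ℚ ℕ→ℚ (countFuns (n H) q (λ c → IsoColᵇ (H ^ c) F)) +ℚ coeffCol ℋ F

-- Every homomorphism h : H → G° is a coloured homomorphism H^c → G for exactly one
-- colouring c of H, namely c = col G ∘ h; so summing hom(H^c, G) over all c recovers
-- hom(H, G°), term by term in the motif.  The same fibre argument applied to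
-- isomorphisms shows that, when col F is injective, the colourings c with H^c ≅ F
-- correspond to the isomorphisms H → F°, one for each; and if ψ is one of these,
-- σ ↦ σ ∘ ψ is a bijection from the automorphisms of F° onto all of them.  Pairwise
-- non-isomorphism of the motif graphs leaves at most one H isomorphic to F°.
module Submission where

open import Defs hiding (sym)
open import Data.Bool using (Bool; true; false; T; _∧_; _∨_; not; if_then_else_)
open import Data.Bool.Properties using (T-∧)
open import Data.Empty using (⊥-elim)
open import Data.Fin using (Fin; zero; suc; punchIn)
open import Data.Fin.Properties using (punchInᵢ≢i)
open import Data.List using ([]; _∷_; tabulate; allFin)
open import Data.List.Properties using (map-tabulate)
open import Data.List.Membership.Propositional using (_∈_; lose)
open import Data.List.Membership.Propositional.Properties using (∈-allFin)
import Data.List.Relation.Unary.All as All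
open import Data.List.Relation.Unary.All.Properties using (all⁺; all⁻)
open import Data.List.Relation.Unary.Any using (here; there; satisfied)
open import Data.List.Relation.Unary.Any.Properties using (any⁺; any⁻)
open import Data.List.Relation.Unary.AllPairs using (AllPairs; _∷_)
open import Data.Nat using (ℕ; zero; suc; _+_; _≟_)
open import Data.Nat.ListAction using (sum)
open import Data.Nat.Properties using (+-0-commutativeMonoid; +-identityʳ; m+n≡0⇒m≡0)
open import Algebra.Properties.CommutativeMonoid.Sum +-0-commutativeMonoid
  using (sum-syntax; sum-cong-≗; sum-replicate-zero; sum-remove; ∑-comm)
  renaming (sum to ∑)
open import Data.Product using (_×_; _,_; proj₁; proj₂; ∃; map₂)
open import Data.Rational using (ℚ; 0ℚ) renaming (_*_ to _*ℚ_; _+_ to _+ℚ_)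
import Data.Rational.Properties as ℚ
open import Data.Vec.Functional using () renaming (_∷_ to _◂_)
open import Data.Vec.Functional.Properties using (∷-cong)
open import Function using (_∘_; id; const)
open import Function.Bundles using (_⇔_; mk⇔; module Equivalence)
open import Function.Definitions using (Bijective; Injective)
open import Relation.Binary.Definitions using (_Respects_)
open import Relation.Binary.PropositionalEquality
  using (_≡_; _≢_; _≗_; refl; sym; trans; cong; cong₂; module ≡-Reasoning)
open import Relation.Nullary using (¬_; yes; no)
open import Relation.Nullary.Decidable
  using (toWitness; fromWitness; toWitnessFalse; fromWitnessFalse)

open Equivalence using (to; from)
open ≡-Reasoning

ind : Bool → ℕ
ind b = if b then 1 else 0

≡ind : ∀ {x} b → (T b → x ≡ 1) → (¬ T b → x ≡ 0) → x ≡ ind b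
≡ind true  x≡1 _   = x≡1 _
≡ind false _   x≡0 = x≡0 id

T⇒ind≡1 : ∀ {b} → T b → ind b ≡ 1
T⇒ind≡1 {true} _ = refl

¬T⇒ind≡0 : ∀ {b} → ¬ T b → ind b ≡ 0
¬T⇒ind≡0 {true}  ¬t = ⊥-elim (¬t _)
¬T⇒ind≡0 {false} _  = refl

T⇒ind≢0 : ∀ {b} → T b → ind b ≢ 0
T⇒ind≢0 {true} _ ()

ind≢0⇒T : ∀ {b} → ind b ≢ 0 → T b
ind≢0⇒T {true}  _     = _
ind≢0⇒T {false} ind≢0 = ind≢0 refl

T-== : ∀ {n} {x y : Fin n} → T (x == y) ⇔ x ≡ y
T-== = mk⇔ toWitness fromWitness

T-not-∨ : ∀ {a b} → T (not a ∨ b) ⇔ (T a → T b)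
T-not-∨ {true}  = mk⇔ const (λ f → f _)
T-not-∨ {false} = mk⇔ (λ _ ()) (const _)

T-⇔ᵇ : ∀ {a b} → T (a ⇔ᵇ b) ⇔ a ≡ b
T-⇔ᵇ {true}  {true}  = mk⇔ (const refl) (const _)
T-⇔ᵇ {true}  {false} = mk⇔ (λ ()) (λ ())
T-⇔ᵇ {false} {true}  = mk⇔ (λ ()) (λ ())
T-⇔ᵇ {false} {false} = mk⇔ (const refl) (const _)

T-allFin? : ∀ n {P : Fin n → Bool} → T (allFin? n P) ⇔ (∀ i → T (P i))
T-allFin? n {P} = mk⇔
  (λ t i → All.lookup (all⁺ P (allFin n) t) (∈-allFin i))
  (λ h → all⁻ P {xs = allFin n} (All.tabulate (λ {i} _ → h i)))

T-anyFin? : ∀ n {P : Fin n → Bool} → T (anyFin? n P) ⇔ ∃ (T ∘ P)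
T-anyFin? n {P} = mk⇔
  (satisfied ∘ any⁻ P (allFin n))
  (λ (i , Pi) → any⁺ P (lose (∈-allFin i) Pi))

∧-respects : ∀ {A : Set} {_≈_ : A → A → Set} (P Q : A → Bool) →
  (T ∘ P) Respects _≈_ → (T ∘ Q) Respects _≈_ → (T ∘ (λ x → P x ∧ Q x)) Respects _≈_
∧-respects P Q P-resp Q-resp x≈y t =
  let Px , Qx = to T-∧ t in from T-∧ (P-resp x≈y Px , Q-resp x≈y Qx)

sum-tabulate : ∀ {m} (g : Fin m → ℕ) → sum (tabulate g) ≡ ∑[ i < m ] g i
sum-tabulate {zero}  g = refl
sum-tabulate {suc m} g = cong (g zero +_) (sum-tabulate (g ∘ suc))

∑-zero : ∀ {m} {g : Fin m → ℕ} → (∀ i → g i ≡ 0) → ∑[ i < m ] g i ≡ 0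
∑-zero {m} g≡0 = trans (sum-cong-≗ g≡0) (sum-replicate-zero m)

∑-single : ∀ {m} (g : Fin m → ℕ) j → (∀ i → i ≢ j → g i ≡ 0) → ∑[ i < m ] g i ≡ g j
∑-single {suc m} g j g≡0 = begin
  ∑ g
    ≡⟨ sum-remove {i = j} g ⟩
  g j + ∑ (g ∘ punchIn j)
    ≡⟨ cong (g j +_) (∑-zero (λ i → g≡0 (punchIn j i) (punchInᵢ≢i j i))) ⟩
  g j + 0
    ≡⟨ +-identityʳ (g j) ⟩
  g j
    ∎

∑-nonzero : ∀ {m} (g : Fin m → ℕ) j → g j ≢ 0 → ∑[ i < m ] g i ≢ 0
∑-nonzero {suc m} g j gj≢0 ∑≡0 =
  gj≢0 (m+n≡0⇒m≡0 (g j) (trans (sym (sum-remove {i = j} g)) ∑≡0))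

∑≢0⇒∃ : ∀ {m} (g : Fin m → ℕ) → ∑[ i < m ] g i ≢ 0 → ∃ λ i → g i ≢ 0
∑≢0⇒∃ {zero}  g ∑≢0 = ⊥-elim (∑≢0 refl)
∑≢0⇒∃ {suc m} g ∑≢0 with g zero ≟ 0
... | no  g₀≢0 = zero , g₀≢0
... | yes g₀≡0 =
  let i , gi≢0 = ∑≢0⇒∃ (g ∘ suc) (∑≢0 ∘ cong₂ _+_ g₀≡0) in suc i , gi≢0

sumFuns-suc : ∀ k m (g : (Fin (suc k) → Fin m) → ℕ) →
  sumFuns (suc k) m g ≡ ∑[ i < m ] sumFuns k m (λ f → g (i ◂ f))
sumFuns-suc k m g = trans (cong sum (map-tabulate id gᵢ)) (sum-tabulate gᵢ)
  where
  gᵢ : Fin m → ℕ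
  gᵢ i = sumFuns k m (λ f → g (i ◂ f))

sumFuns-cong : ∀ k m {g h : (Fin k → Fin m) → ℕ} →
  (∀ f → g f ≡ h f) → sumFuns k m g ≡ sumFuns k m h
sumFuns-cong zero    m g≡h = g≡h _
sumFuns-cong (suc k) m {g} {h} g≡h = begin
  sumFuns (suc k) m g
    ≡⟨ sumFuns-suc k m g ⟩
  ∑[ i < m ] sumFuns k m (λ f → g (i ◂ f))
    ≡⟨ sum-cong-≗ (λ i → sumFuns-cong k m (g≡h ∘ (i ◂_))) ⟩
  ∑[ i < m ] sumFuns k m (λ f → h (i ◂ f))
    ≡⟨ sumFuns-suc k m h ⟨
  sumFuns (suc k) m h
    ∎

sumFuns-zero : ∀ k m {g : (Fin k → Fin m) → ℕ} → (∀ f → g f ≡ 0) → sumFuns k m g ≡ 0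
sumFuns-zero zero    m g≡0 = g≡0 _
sumFuns-zero (suc k) m {g} g≡0 =
  trans (sumFuns-suc k m g) (∑-zero (λ i → sumFuns-zero k m (g≡0 ∘ (i ◂_))))

sumFuns-∑-comm : ∀ k m {n} (g : (Fin k → Fin m) → Fin n → ℕ) →
  sumFuns k m (λ f → ∑[ i < n ] g f i) ≡ ∑[ i < n ] sumFuns k m (λ f → g f i)
sumFuns-∑-comm zero    m     g = refl
sumFuns-∑-comm (suc k) m {n} g = begin
  sumFuns (suc k) m (λ f → ∑[ i < n ] g f i)
    ≡⟨ sumFuns-suc k m (λ f → ∑[ i < n ] g f i) ⟩
  ∑[ j < m ] sumFuns k m (λ f → ∑[ i < n ] g (j ◂ f) i)
    ≡⟨ sum-cong-≗ (λ j → sumFuns-∑-comm k m {n} (g ∘ (j ◂_))) ⟩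
  ∑[ j < m ] ∑[ i < n ] sumFuns k m (λ f → g (j ◂ f) i)
    ≡⟨ ∑-comm (λ j i → sumFuns k m (λ f → g (j ◂ f) i)) ⟩
  ∑[ i < n ] ∑[ j < m ] sumFuns k m (λ f → g (j ◂ f) i)
    ≡⟨ sum-cong-≗ (λ i → sumFuns-suc k m (λ f → g f i)) ⟨
  ∑[ i < n ] sumFuns (suc k) m (λ f → g f i)
    ∎

sumFuns-comm : ∀ k m k′ m′ (g : (Fin k → Fin m) → (Fin k′ → Fin m′) → ℕ) →
  sumFuns k m (λ f → sumFuns k′ m′ (g f))
    ≡ sumFuns k′ m′ (λ f′ → sumFuns k m (λ f → g f f′))
sumFuns-comm zero    m k′ m′ g = refl
sumFuns-comm (suc k) m k′ m′ g = begin
  sumFuns (suc k) m (λ f → sumFuns k′ m′ (g f))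
    ≡⟨ sumFuns-suc k m (λ f → sumFuns k′ m′ (g f)) ⟩
  ∑[ i < m ] sumFuns k m (λ f → sumFuns k′ m′ (g (i ◂ f)))
    ≡⟨ sum-cong-≗ (λ i → sumFuns-comm k m k′ m′ (g ∘ (i ◂_))) ⟩
  ∑[ i < m ] sumFuns k′ m′ (λ f′ → sumFuns k m (λ f → g (i ◂ f) f′))
    ≡⟨ sumFuns-∑-comm k′ m′ (λ f′ i → sumFuns k m (λ f → g (i ◂ f) f′)) ⟨
  sumFuns k′ m′ (λ f′ → ∑[ i < m ] sumFuns k m (λ f → g (i ◂ f) f′))
    ≡⟨ sumFuns-cong k′ m′ (λ f′ → sumFuns-suc k m (λ f → g f f′)) ⟨
  sumFuns k′ m′ (λ f′ → sumFuns (suc k) m (λ f → g f f′))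
    ∎

sumFuns≢0⇒∃ : ∀ k m (g : (Fin k → Fin m) → ℕ) → sumFuns k m g ≢ 0 → ∃ λ f → g f ≢ 0
sumFuns≢0⇒∃ zero    m g sum≢0 = (λ ()) , sum≢0
sumFuns≢0⇒∃ (suc k) m g sum≢0 =
  let i , sumᵢ≢0 = ∑≢0⇒∃ _ (sum≢0 ∘ trans (sumFuns-suc k m g))
      f , gif≢0  = sumFuns≢0⇒∃ k m _ sumᵢ≢0
  in i ◂ f , gif≢0

≗-head◂tail : ∀ {k m} (f : Fin (suc k) → Fin m) → f ≗ (f zero ◂ f ∘ suc)
≗-head◂tail f = ∷-cong refl (λ _ → refl)

FunPred : ℕ → ℕ → Set
FunPred k m = (Fin k → Fin m) → Bool

countFuns-none : ∀ k m {P : FunPred k m} → (∀ f → ¬ T (P f)) → countFuns k m P ≡ 0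
countFuns-none k m ¬P = sumFuns-zero k m (¬T⇒ind≡0 ∘ ¬P)

-- Without function extensionality a predicate on maps must be assumed to respect ≗.
countFuns-unique : ∀ k m {P : FunPred k m} → (T ∘ P) Respects _≗_ →
  ∀ f₀ → T (P f₀) → (∀ f → T (P f) → f ≗ f₀) → countFuns k m P ≡ 1
countFuns-unique zero    m resp _ Pf₀ _ = T⇒ind≡1 (resp (λ ()) Pf₀)
countFuns-unique (suc k) m {P} resp f₀ Pf₀ unique = begin
  countFuns (suc k) m P
    ≡⟨ sumFuns-suc k m (ind ∘ P) ⟩
  ∑[ i < m ] countFuns k m (λ f → P (i ◂ f))
    ≡⟨ ∑-single _ (f₀ zero) off-head ⟩
  countFuns k m (λ f → P (f₀ zero ◂ f))
    ≡⟨ countFuns-unique k m (resp ∘ ∷-cong refl) (f₀ ∘ suc)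
         (resp (≗-head◂tail f₀) Pf₀) (λ f Pf → unique _ Pf ∘ suc) ⟩
  1
    ∎
  where
  off-head : ∀ i → i ≢ f₀ zero → countFuns k m (λ f → P (i ◂ f)) ≡ 0
  off-head i i≢f₀0 = countFuns-none k m (λ f Pif → i≢f₀0 (unique _ Pif zero))

countFuns-pos : ∀ k m {P : FunPred k m} → (T ∘ P) Respects _≗_ →
  ∀ f → T (P f) → countFuns k m P ≢ 0
countFuns-pos zero    m resp _ Pf = T⇒ind≢0 (resp (λ ()) Pf)
countFuns-pos (suc k) m {P} resp f Pf =
  ∑-nonzero _ (f zero)
    (countFuns-pos k m (resp ∘ ∷-cong refl) (f ∘ suc) (resp (≗-head◂tail f) Pf))
  ∘ trans (sym (sumFuns-suc k m (ind ∘ P)))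

countFuns≢0⇒∃ : ∀ k m {P : FunPred k m} → countFuns k m P ≢ 0 → ∃ λ f → T (P f)
countFuns≢0⇒∃ k m count≢0 = map₂ ind≢0⇒T (sumFuns≢0⇒∃ k m _ count≢0)

anyFun-sound : ∀ k m {P : FunPred k m} → T (anyFun k m P) → ∃ λ f → T (P f)
anyFun-sound k m = countFuns≢0⇒∃ k m ∘ toWitnessFalse

anyFun-complete : ∀ k m {P : FunPred k m} → (T ∘ P) Respects _≗_ →
  ∀ f → T (P f) → T (anyFun k m P)
anyFun-complete k m resp f = fromWitnessFalse ∘ countFuns-pos k m resp f

countFuns≡ind-anyFun : ∀ k m {P : FunPred k m} → (T ∘ P) Respects _≗_ →
  (∀ {f f′} → T (P f) → T (P f′) → f ≗ f′) → countFuns k m P ≡ ind (anyFun k m P)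
countFuns≡ind-anyFun k m {P} resp unique with countFuns k m P ≟ 0
... | yes count≡0 = count≡0
... | no  count≢0 =
  let f₀ , Pf₀ = countFuns≢0⇒∃ k m count≢0
  in countFuns-unique k m resp f₀ Pf₀ (λ _ Pf → unique Pf Pf₀)

_≐ᵇ_ : ∀ {k m} → (Fin k → Fin m) → (Fin k → Fin m) → Bool
_≐ᵇ_ {k} f g = allFin? k (λ v → f v == g v)

T-≐ᵇ : ∀ {k m} {f g : Fin k → Fin m} → T (f ≐ᵇ g) ⇔ f ≗ g
T-≐ᵇ {k} = mk⇔
  (λ t v → to T-== (to (T-allFin? k) t v))
  (λ f≗g → from (T-allFin? k) (from T-== ∘ f≗g))

countFuns-singleton : ∀ k m b (d : Fin k → Fin m) → countFuns k m (λ c → b ∧ d ≐ᵇ c) ≡ ind b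
countFuns-singleton k m false d = countFuns-none k m (λ _ ())
countFuns-singleton k m true  d =
  countFuns-unique k m resp d (from (T-≐ᵇ {f = d} {d}) (λ _ → refl))
    (λ _ t → sym ∘ to T-≐ᵇ t)
  where
  resp : (T ∘ (d ≐ᵇ_)) Respects _≗_
  resp c≗c′ t = from T-≐ᵇ (λ v → trans (to T-≐ᵇ t v) (c≗c′ v))

countFuns-fibres : ∀ k m k′ m′ (Φ : (Fin k → Fin m) → Fin k′ → Fin m′) (P : FunPred k m) →
  sumFuns k′ m′ (λ c → countFuns k m (λ f → P f ∧ Φ f ≐ᵇ c)) ≡ countFuns k m P
countFuns-fibres k m k′ m′ Φ P = trans
  (sumFuns-comm k′ m′ k m _)
  (sumFuns-cong k m (λ f → countFuns-singleton k′ m′ (P f) (Φ f)))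

-- Homomorphism counts of the underlying graph

hom≡∑-homCol : ∀ {q} (H : Graph) (G : ColGraph q) →
  hom H (G °) ≡ sumFuns (n H) q (λ c → homCol (H ^ c) G)
hom≡∑-homCol {q} H G =
  sym (countFuns-fibres (n H) (n (G °)) (n H) q (col G ∘_) (isHomᵇ H (G °)))

p≡pcol : ∀ {q} (ℋ : Motif) (G : ColGraph q) → p ℋ (G °) ≡ pcol ℋ G
p≡pcol []            G = refl
p≡pcol ((H , α) ∷ ℋ) G =
  cong₂ (λ x y → α *ℚ ℕ→ℚ x +ℚ y) (hom≡∑-homCol H G) (p≡pcol ℋ G)

-- Isomorphisms

record IsIso (A B : Graph) (f : Fin (n A) → Fin (n B)) : Set where
  field
    injective  : Injective _≡_ _≡_ f
    surjective : ∀ w → ∃ λ u → f u ≡ w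
    adj-≡      : ∀ u v → adj A u v ≡ adj B (f u) (f v)

  inverse : Fin (n B) → Fin (n A)
  inverse = proj₁ ∘ surjective

  inverseʳ : ∀ w → f (inverse w) ≡ w
  inverseʳ = proj₂ ∘ surjective

  inverseˡ : ∀ u → inverse (f u) ≡ u
  inverseˡ u = injective (inverseʳ (f u))
open IsIso

T-isIsoMapᵇ : ∀ A B {f} → T (isIsoMapᵇ A B f) ⇔ IsIso A B f
T-isIsoMapᵇ A B {f} = mk⇔ sound complete
  where
  sound : T (isIsoMapᵇ A B f) → IsIso A B f
  sound t =
    let bij , adj≡ = to T-∧ t
        inj , surj = to T-∧ bij
    in record
      { injective  = λ {u} {v} →
          to T-== ∘ to T-not-∨ (to (T-allFin? (n A)) (to (T-allFin? (n A)) inj u) v) ∘ from T-==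
      ; surjective = λ w →
          map₂ (to T-==) (to (T-anyFin? (n A)) (to (T-allFin? (n B)) surj w))
      ; adj-≡      = λ u v →
          to T-⇔ᵇ (to (T-allFin? (n A)) (to (T-allFin? (n A)) adj≡ u) v)
      }

  complete : IsIso A B f → T (isIsoMapᵇ A B f)
  complete I = from T-∧ (from T-∧ (inj , surj) , adj≡)
    where
    inj  : T (allFin? (n A) λ u → allFin? (n A) λ v → not (f u == f v) ∨ (u == v))
    surj : T (allFin? (n B) λ w → anyFin? (n A) λ u → f u == w)
    adj≡ : T (allFin? (n A) λ u → allFin? (n A) λ v → adj A u v ⇔ᵇ adj B (f u) (f v))
    inj  = from (T-allFin? (n A)) λ u → from (T-allFin? (n A)) λ v →
             from T-not-∨ (from T-== ∘ injective I ∘ to T-==)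
    surj = from (T-allFin? (n B)) λ w →
             from (T-anyFin? (n A)) (map₂ (from T-==) (surjective I w))
    adj≡ = from (T-allFin? (n A)) λ u → from (T-allFin? (n A)) λ v →
             from T-⇔ᵇ (adj-≡ I u v)

IsIso-∘ : ∀ {A B C f g} → IsIso A B f → IsIso B C g → IsIso A C (g ∘ f)
IsIso-∘ {f = f} {g} I J = record
  { injective  = injective I ∘ injective J
  ; surjective = λ w →
      let v , gv≡w = surjective J w
          u , fu≡v = surjective I v
      in u , trans (cong g fu≡v) gv≡w
  ; adj-≡      = λ u v → trans (adj-≡ I u v) (adj-≡ J (f u) (f v))
  }

IsIso-inverse : ∀ {A B f} (I : IsIso A B f) → IsIso B A (inverse I)
IsIso-inverse {A} {B} {f} I = record
  { injective  = λ {w} {w′} eq →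
      trans (sym (inverseʳ I w)) (trans (cong f eq) (inverseʳ I w′))
  ; surjective = λ u → f u , inverseˡ I u
  ; adj-≡      = λ w w′ →
      trans (cong₂ (adj B) (sym (inverseʳ I w)) (sym (inverseʳ I w′)))
            (sym (adj-≡ I (inverse I w) (inverse I w′)))
  }

IsIso-resp : ∀ {A B f g} → f ≗ g → IsIso A B f → IsIso A B g
IsIso-resp {B = B} f≗g I = record
  { injective  = λ {u} {v} gu≡gv →
      injective I (trans (f≗g u) (trans gu≡gv (sym (f≗g v))))
  ; surjective = λ w → let u , fu≡w = surjective I w in u , trans (sym (f≗g u)) fu≡w
  ; adj-≡      = λ u v → trans (adj-≡ I u v) (cong₂ (adj B) (f≗g u) (f≗g v))
  }

isIsoMapᵇ-resp : ∀ A B → (T ∘ isIsoMapᵇ A B) Respects _≗_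
isIsoMapᵇ-resp A B f≗g = from (T-isIsoMapᵇ A B) ∘ IsIso-resp f≗g ∘ to (T-isIsoMapᵇ A B)

Iso⇔∃IsIso : ∀ A B → Iso A B ⇔ ∃ (IsIso A B)
Iso⇔∃IsIso A B = mk⇔
  (map₂ (to (T-isIsoMapᵇ A B)) ∘ anyFun-sound (n A) (n B) {isIsoMapᵇ A B})
  (λ (f , I) →
    anyFun-complete (n A) (n B) (isIsoMapᵇ-resp A B) f (from (T-isIsoMapᵇ A B) I))

Iso-sym : ∀ {A B} → Iso A B → Iso B A
Iso-sym {A} {B} A≅B =
  let _ , I = to (Iso⇔∃IsIso A B) A≅B in from (Iso⇔∃IsIso B A) (_ , IsIso-inverse I)

Iso-trans : ∀ {A B C} → Iso A B → Iso B C → Iso A C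
Iso-trans {A} {B} {C} A≅B B≅C =
  let _ , I = to (Iso⇔∃IsIso A B) A≅B
      _ , J = to (Iso⇔∃IsIso B C) B≅C
  in from (Iso⇔∃IsIso A C) (_ , IsIso-∘ I J)

#iso≡aut : ∀ {H K ψ} → IsIso H K ψ → countFuns (n H) (n K) (isIsoMapᵇ H K) ≡ aut K
#iso≡aut {H} {K} {ψ} J = begin
  countFuns (n H) (n K) (isIsoMapᵇ H K)
    ≡⟨ sumFuns-cong (n H) (n K) autos-onto ⟨
  sumFuns (n H) (n K) (λ φ → countFuns (n K) (n K) (λ σ → isIsoMapᵇ K K σ ∧ (σ ∘ ψ) ≐ᵇ φ))
    ≡⟨ countFuns-fibres (n K) (n K) (n H) (n K) (_∘ ψ) (isIsoMapᵇ K K) ⟩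
  aut K
    ∎
  where
  autos-onto : ∀ φ → countFuns (n K) (n K) (λ σ → isIsoMapᵇ K K σ ∧ (σ ∘ ψ) ≐ᵇ φ)
                     ≡ ind (isIsoMapᵇ H K φ)
  autos-onto φ = ≡ind _ unique none
    where
    resp : (T ∘ (λ σ → isIsoMapᵇ K K σ ∧ (σ ∘ ψ) ≐ᵇ φ)) Respects _≗_
    resp = ∧-respects (isIsoMapᵇ K K) (λ σ → (σ ∘ ψ) ≐ᵇ φ) (isIsoMapᵇ-resp K K)
      (λ σ≗σ′ t → from T-≐ᵇ (λ v → trans (sym (σ≗σ′ (ψ v))) (to T-≐ᵇ t v)))

    unique : T (isIsoMapᵇ H K φ) → _
    unique t = countFuns-unique (n K) (n K) resp (φ ∘ inverse J)
      (from T-∧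
        ( from (T-isIsoMapᵇ K K) (IsIso-∘ (IsIso-inverse J) (to (T-isIsoMapᵇ H K) t))
        , from T-≐ᵇ (cong φ ∘ inverseˡ J)))
      (λ σ u w →
        trans (cong σ (sym (inverseʳ J w))) (to T-≐ᵇ (proj₂ (to T-∧ u)) (inverse J w)))

    none : ¬ T (isIsoMapᵇ H K φ) → _
    none ¬iso = countFuns-none (n K) (n K) λ σ u →
      let aut-σ , σψ≐φ = to T-∧ u
      in ¬iso (from (T-isIsoMapᵇ H K)
           (IsIso-resp (to T-≐ᵇ σψ≐φ) (IsIso-∘ J (to (T-isIsoMapᵇ K K) aut-σ))))

-- Coefficients after collecting isomorphic terms

#isoColourings : ∀ {q} → Graph → ColGraph q → ℕ
#isoColourings {q} H F = countFuns (n H) q (λ c → IsoColᵇ (H ^ c) F)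

#isoColourings≡#iso : ∀ {q} (H : Graph) (F : ColGraph q) → Injective _≡_ _≡_ (col F) →
  #isoColourings H F ≡ countFuns (n H) (n (F °)) (isIsoMapᵇ H (F °))
#isoColourings≡#iso {q} H F col-inj = trans
  (sym (sumFuns-cong (n H) q (λ c → countFuns≡ind-anyFun (n H) (n (F °)) (resp c) unique)))
  (countFuns-fibres (n H) (n (F °)) (n H) q (col F ∘_) (isIsoMapᵇ H (F °)))
  where
  resp : ∀ c → (T ∘ (λ φ → isIsoMapᵇ H (F °) φ ∧ (col F ∘ φ) ≐ᵇ c)) Respects _≗_
  resp c = ∧-respects (isIsoMapᵇ H (F °)) (λ φ → (col F ∘ φ) ≐ᵇ c)
    (isIsoMapᵇ-resp H (F °))
    (λ φ≗φ′ t → from T-≐ᵇ (λ v → trans (cong (col F) (sym (φ≗φ′ v))) (to T-≐ᵇ t v)))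

  unique : ∀ {c φ φ′} → T (isIsoMapᵇ H (F °) φ ∧ (col F ∘ φ) ≐ᵇ c) →
    T (isIsoMapᵇ H (F °) φ′ ∧ (col F ∘ φ′) ≐ᵇ c) → φ ≗ φ′
  unique t t′ v =
    col-inj (trans (to T-≐ᵇ (proj₂ (to T-∧ t)) v) (sym (to T-≐ᵇ (proj₂ (to T-∧ t′)) v)))

#isoColourings≡aut : ∀ {q} (H : Graph) (F : ColGraph q) → Injective _≡_ _≡_ (col F) →
  Iso H (F °) → #isoColourings H F ≡ aut (F °)
#isoColourings≡aut H F col-inj H≅F =
  trans (#isoColourings≡#iso H F col-inj) (#iso≡aut (proj₂ (to (Iso⇔∃IsIso H (F °)) H≅F)))

#isoColourings≡0 : ∀ {q} (H : Graph) (F : ColGraph q) → ¬ Iso H (F °) → #isoColourings H F ≡ 0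
#isoColourings≡0 {q} H F H≇F = countFuns-none (n H) q λ c t →
  let φ , u = anyFun-sound (n H) (n (F °))
                {λ φ → isIsoMapᵇ H (F °) φ ∧ preservesColᵇ (H ^ c) F φ} t
  in H≇F (from (Iso⇔∃IsIso H (F °)) (φ , to (T-isIsoMapᵇ H (F °)) (proj₁ (to T-∧ u))))

*ℕ→ℚ-zero : ∀ α {k} → k ≡ 0 → α *ℚ ℕ→ℚ k ≡ 0ℚ
*ℕ→ℚ-zero α refl = ℚ.*-zeroʳ α

coeffCol-nonIso : ∀ {q} (ℋ : Motif) (F : ColGraph q) →
  ((H : Graph) (α : ℚ) → (H , α) ∈ ℋ → ¬ Iso H (F °)) → coeffCol ℋ F ≡ 0ℚ
coeffCol-nonIso []            F _    = refl
coeffCol-nonIso ((H , α) ∷ ℋ) F ℋ≇F = trans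
  (cong₂ _+ℚ_ (*ℕ→ℚ-zero α (#isoColourings≡0 H F (ℋ≇F H α (here refl))))
              (coeffCol-nonIso ℋ F (λ H′ α′ → ℋ≇F H′ α′ ∘ there)))
  (ℚ.+-identityʳ 0ℚ)

coeffCol-iso : ∀ {q} (ℋ : Motif) (F : ColGraph q) →
  AllPairs (λ Hα Hβ → ¬ Iso (proj₁ Hα) (proj₁ Hβ)) ℋ → Injective _≡_ _≡_ (col F) →
  (H : Graph) (α : ℚ) → (H , α) ∈ ℋ → Iso H (F °) →
  coeffCol ℋ F ≡ α *ℚ ℕ→ℚ (aut (F °))
coeffCol-iso (_ ∷ ℋ) F (H≇ℋ ∷ _) col-inj H α (here refl) H≅F = trans
  (cong₂ _+ℚ_ (cong (λ k → α *ℚ ℕ→ℚ k) (#isoColourings≡aut H F col-inj H≅F))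
              (coeffCol-nonIso ℋ F (λ H′ _ H′∈ℋ H′≅F →
                 All.lookup H≇ℋ H′∈ℋ
                   (Iso-trans {H} {F °} {H′} H≅F (Iso-sym {H′} {F °} H′≅F)))))
  (ℚ.+-identityʳ _)
coeffCol-iso ((H′ , α′) ∷ ℋ) F (H′≇ℋ ∷ distinct) col-inj H α (there H∈ℋ) H≅F = trans
  (cong₂ _+ℚ_ (*ℕ→ℚ-zero α′ (#isoColourings≡0 H′ F (λ H′≅F →
                 All.lookup H′≇ℋ H∈ℋ
                   (Iso-trans {H′} {F °} {H} H′≅F (Iso-sym {H} {F °} H≅F)))))
              (coeffCol-iso ℋ F distinct col-inj H α H∈ℋ H≅F))
  (ℚ.+-identityˡ _)

lemma4p1 : (q : ℕ) (ℋ : Motif)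
    → AllPairs (λ Hα Hβ → ¬ Iso (proj₁ Hα) (proj₁ Hβ)) ℋ
    → ((G : ColGraph q) → p ℋ (G °) ≡ pcol ℋ G)
      × ((F : ColGraph q) → Bijective _≡_ _≡_ (col F)
          → ((H : Graph) (α : ℚ) → (H , α) ∈ ℋ → Iso H (F °)
               → coeffCol ℋ F ≡ α *ℚ ℕ→ℚ (aut (F °)))
            × (((H : Graph) (α : ℚ) → (H , α) ∈ ℋ → ¬ Iso H (F °))
               → coeffCol ℋ F ≡ 0ℚ))
lemma4p1 q ℋ distinct =
  p≡pcol ℋ , λ F col-bij → coeffCol-iso ℋ F distinct (proj₁ col-bij) , coeffCol-nonIso ℋ F
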